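{- For $d$ even, $(d/2)!\le|\mathcal{F}(d)|\le2\left(\tfrac32d\right)^{\frac32d}$.
   Context: A forest is good if no vertex is isolated and every internal (non-leaf) vertex has even degree at least $4$ (the empty forest is good). $\mathcal{F}(d)$ is the set of good forests with exactly $d$ leaves, the leaves labelled bijectively by $[d]$ and internal vertices unlabelled, where two such forests are identified if they are isomorphic as partially labelled graphs. -}

module Defs where

open import Data.Nat using (ℕ; zero; suc; _+_; _*_; _≤_)
open import Data.Nat.Divisibility using (_∣_)
open import Data.Bool using (Bool; true; false; if_then_else_)
open import Data.Fin using (Fin; zero; suc; inject₁; fromℕ; _↑ˡ_; _↑ʳ_)
open import Data.List using (List; allFin; map)
open import Data.Nat.ListAction using (sum)
open import Data.Product using (Σ; _×_)
open import Relation.Binary.PropositionalEquality using (_≡_; _≢_)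
open import Relation.Nullary using (¬_)
open import Function.Definitions using (Injective; Bijective)

record Graph (n : ℕ) : Set where
  field
    adj    : Fin n → Fin n → Bool
    sym    : ∀ u v → adj u v ≡ adj v u
    irrefl : ∀ v → adj v v ≡ false
open Graph public

record Cycle {n : ℕ} (G : Graph n) : Set where
  field
    m      : ℕ
    c      : Fin (3 + m) → Fin n
    inj    : Injective _≡_ _≡_ c
    linked : ∀ (i : Fin (2 + m)) → adj G (c (inject₁ i)) (c (suc i)) ≡ true
    closed : adj G (c (fromℕ (2 + m))) (c zero) ≡ true

IsForest : {n : ℕ} → Graph n → Set
IsForest G = ¬ Cycle G

degree : {n : ℕ} → Graph n → Fin n → ℕ
degree {n} G v = sum (map (λ u → if adj G v u then 1 else 0) (allFin n))

IsGood : {n : ℕ} → Graph n → Set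
IsGood {n} G = (∀ v → 1 ≤ degree G v)
             × (∀ v → degree G v ≢ 1 → (4 ≤ degree G v × 2 ∣ degree G v))

-- A good forest with exactly d leaves labelled by [d]: the vertex set is Fin (d + k),
-- the first d vertices are exactly the leaves (vertex i ↑ˡ k carries label i),
-- the remaining k vertices are the (unlabelled) internal vertices.
record GoodForest (d : ℕ) : Set where
  field
    k        : ℕ
    graph    : Graph (d + k)
    forest   : IsForest graph
    good     : IsGood graph
    leaves   : ∀ (i : Fin d) → degree graph (i ↑ˡ k) ≡ 1
    internal : ∀ (j : Fin k) → degree graph (d ↑ʳ j) ≢ 1
open GoodForest public

record Iso {d : ℕ} (F F' : GoodForest d) : Set where
  field
    σ        : Fin (d + k F) → Fin (d + k F')
    bij      : Bijective _≡_ _≡_ σ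
    labels   : ∀ (i : Fin d) → σ (i ↑ˡ k F) ≡ i ↑ˡ k F'
    preserve : ∀ u v → adj (graph F') (σ u) (σ v) ≡ adj (graph F) u v

-- |𝓕(d)| = N : there are N isomorphism classes, given by a complete list of
-- pairwise non-isomorphic representatives.
HasCardinality : ℕ → ℕ → Set
HasCardinality d N =
  Σ (Fin N → GoodForest d) λ f →
    (∀ i j → Iso (f i) (f j) → i ≡ j) × (∀ F → Σ (Fin N) λ i → Iso F (f i))

-- Upper bound: removing a leaf and recursing shows that every forest on n vertices is the
-- graph of a parent function Fin n → Fin n, and that it has at most n edges. Since leaves
-- have degree 1 and internal vertices degree at least 4, a good forest with d = 2m leaves
-- has k ≤ m internal vertices. Hence every isomorphism class is represented among the
-- (d + k)^(d + k) parent functions with k ≤ m, at most 2 (3m)^(3m) codes in all; goodness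
-- and isomorphism are decidable by exhaustive search, so discarding the codes that are not
-- good forests and then duplicates up to isomorphism leaves a complete list of classes.
--
-- Lower bound: a permutation π of [m] gives the perfect matching i ↔ m + π(i), a good
-- forest without internal vertices. An isomorphism fixes all leaves, i.e. all vertices,
-- so distinct permutations give non-isomorphic forests.

module Submission where

open import Defs hiding (sym)
open import Data.Nat using (ℕ; zero; suc; _+_; _*_; _^_; _≤_; _<_; _≤?_; _!; z≤n; s≤s; s≤s⁻¹)
import Data.Nat.Properties as ℕ
open import Data.Nat.Divisibility using (_∣_; _∣?_)
open import Data.Nat.ListAction using (sum)
open import Data.Nat.Tactic.RingSolver using (solve-∀)
open import Algebra.Properties.CommutativeMonoid.Sum ℕ.+-0-commutativeMonoid
  using (sum-remove; ∑-distrib-+; sum-cong-≗) renaming (sum to ∑)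
open import Data.Bool using (Bool; true; false; if_then_else_)
import Data.Bool as Bool
open import Data.Product using (Σ; _×_; _,_; proj₁; proj₂; ∃; uncurry)
open import Data.Sum using (_⊎_; inj₁; inj₂)
import Data.Sum as Sum
open import Data.Empty using (⊥-elim)
open import Data.Maybe using (Maybe)
import Data.Maybe as Maybe
import Data.Maybe.Relation.Unary.Any as MaybeAny
open import Data.Fin using (Fin; zero; suc; toℕ; cast; splitAt; join; remQuot; combine; punchIn; punchOut;
                            inject₁; fromℕ; fromℕ<; _↑ˡ_; _↑ʳ_; finToFun; funToFin)
import Data.Fin.Properties as Fin
open import Data.Fin.Properties using (_≟_; any?; all?)
open import Data.Fin.Permutation using (Permutation; Permutation′; _⟨$⟩ʳ_; _⟨$⟩ˡ_)
import Data.Fin.Permutation as Perm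
open import Data.List using (List; tabulate; allFin; lookup; length; deduplicate; mapMaybe; _++_)
import Data.List.Properties as List
open import Data.List.Relation.Unary.Any using (Any)
import Data.List.Relation.Unary.Any as Any
import Data.List.Relation.Unary.Any.Properties as Any
import Data.List.Relation.Unary.All as All
open import Data.List.Membership.Propositional.Properties using (∈-lookup; ∈-allFin)
open import Data.List.Relation.Unary.Unique.DecSetoid.Properties using (deduplicate-!)
open import Level using (0ℓ)
open import Relation.Nullary using (¬_; Dec; yes; no; contradiction)
open import Relation.Nullary.Decidable
  using (does; map′; dec⇒maybe; decidable-stable; ¬?; _×-dec_; _⊎-dec_; _→-dec_; does-⇔; dec-true; dec-false)
open import Relation.Binary.Bundles using (Setoid; DecSetoid)
open import Relation.Binary.Definitions using (tri<; tri≈; tri>)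
open import Relation.Binary.PropositionalEquality
open import Function using (_∘_; id; case_of_)
open import Function.Bundles using (_⇔_; mk⇔; mk⤖; module Equivalence; module Bijection; module Inverse)
open import Function.Definitions using (Injective; Surjective; Bijective)
open import Function.Properties.Bijection using (⤖⇒↔)
open import Function.Properties.Inverse using (↔⇒⤖)
open import Function.Construct.Composition using (_⇔-∘_)
import Function.Construct.Composition as Composition
import Function.Construct.Identity as Identity
open import Function.Construct.Symmetry using (⇔-sym; ↔-sym)

-- Finite sums

∑-zero : ∀ {n} (f : Fin n → ℕ) → (∀ x → f x ≡ 0) → ∑ f ≡ 0
∑-zero {zero}  f f≡0 = refl
∑-zero {suc n} f f≡0 rewrite f≡0 zero = ∑-zero (f ∘ suc) (f≡0 ∘ suc)

∑-single : ∀ {n} (z : Fin n) (f : Fin n → ℕ) → (∀ x → x ≢ z → f x ≡ 0) → ∑ f ≡ f z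
∑-single {suc n} z f f≡0 = begin
  ∑ f                        ≡⟨ sum-remove {i = z} f ⟩
  f z + ∑ (f ∘ punchIn z)    ≡⟨ cong (f z +_) (∑-zero _ (λ x → f≡0 _ (Fin.punchInᵢ≢i z x))) ⟩
  f z + 0                    ≡⟨ ℕ.+-identityʳ (f z) ⟩
  f z                        ∎
  where open ≡-Reasoning

≤-∑ : ∀ {n} (z : Fin n) (f : Fin n → ℕ) → f z ≤ ∑ f
≤-∑ {suc n} z f = subst (f z ≤_) (sym (sum-remove {i = z} f)) (ℕ.m≤m+n (f z) _)

∑-↑ : ∀ m {n} (f : Fin (m + n) → ℕ) → ∑ f ≡ ∑ (f ∘ (_↑ˡ n)) + ∑ (f ∘ (m ↑ʳ_))
∑-↑ zero    f = refl
∑-↑ (suc m) f = trans (cong (f zero +_) (∑-↑ m (f ∘ suc))) (sym (ℕ.+-assoc (f zero) _ _))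

∑-lowerBound : ∀ {n} c (f : Fin n → ℕ) → (∀ x → c ≤ f x) → n * c ≤ ∑ f
∑-lowerBound {zero}  c f c≤f = z≤n
∑-lowerBound {suc n} c f c≤f = ℕ.+-mono-≤ (c≤f zero) (∑-lowerBound c (f ∘ suc) (c≤f ∘ suc))

sum-tabulate : ∀ {n} (f : Fin n → ℕ) → sum (tabulate f) ≡ ∑ f
sum-tabulate {zero}  f = refl
sum-tabulate {suc n} f = cong (f zero +_) (sum-tabulate (f ∘ suc))

powerSum : ℕ → ℕ → ℕ → ℕ
powerSum b E zero    = b ^ (E + 0)
powerSum b E (suc K) = b ^ (E + suc K) + powerSum b E K

powerSum-≤ : ∀ b E K → (1 ≤ K → 2 ≤ b) → powerSum b E K ≤ 2 * b ^ (E + K)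
powerSum-≤ b E zero    _   = ℕ.m≤m+n _ _
powerSum-≤ b E (suc K) 2≤b = begin
  b ^ (E + suc K) + powerSum b E K        ≤⟨ ℕ.+-monoʳ-≤ (b ^ (E + suc K)) (powerSum-≤ b E K λ _ → 2≤b 1≤1+K) ⟩
  b ^ (E + suc K) + 2 * b ^ (E + K)       ≤⟨ ℕ.+-monoʳ-≤ (b ^ (E + suc K)) (ℕ.*-monoˡ-≤ (b ^ (E + K)) (2≤b 1≤1+K)) ⟩
  b ^ (E + suc K) + b ^ suc (E + K)       ≡⟨ cong (b ^ (E + suc K) +_) (cong (b ^_) (ℕ.+-suc E K)) ⟨
  b ^ (E + suc K) + b ^ (E + suc K)       ≡⟨ cong (b ^ (E + suc K) +_) (ℕ.+-identityʳ _) ⟨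
  2 * b ^ (E + suc K)                     ∎
  where
  open ℕ.≤-Reasoning
  1≤1+K = s≤s z≤n

-- Degrees and vertex deletion

𝟙 : Bool → ℕ
𝟙 b = if b then 1 else 0

𝟙≤1 : ∀ b → 𝟙 b ≤ 1
𝟙≤1 true  = s≤s z≤n
𝟙≤1 false = z≤n

degree-∑ : ∀ {n} (G : Graph n) v → degree G v ≡ ∑ (λ u → 𝟙 (adj G v u))
degree-∑ {n} G v = trans (cong sum (List.map-tabulate {n = n} id (𝟙 ∘ adj G v))) (sum-tabulate (𝟙 ∘ adj G v))

_≈ᴳ_ : ∀ {n} → Graph n → Graph n → Set
G ≈ᴳ H = ∀ u v → adj G u v ≡ adj H u v

degree-cong : ∀ {n} {G H : Graph n} → G ≈ᴳ H → ∀ v → degree G v ≡ degree H v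
degree-cong {G = G} {H} G≈H v =
  trans (degree-∑ G v) (trans (sum-cong-≗ (λ u → cong 𝟙 (G≈H v u))) (sym (degree-∑ H v)))

cycle-cong : ∀ {n} {G H : Graph n} → G ≈ᴳ H → Cycle G → Cycle H
cycle-cong G≈H C = record
  { m      = Cycle.m C
  ; c      = Cycle.c C
  ; inj    = Cycle.inj C
  ; linked = λ i → trans (sym (G≈H _ _)) (Cycle.linked C i)
  ; closed = trans (sym (G≈H _ _)) (Cycle.closed C)
  }

degree≤1⇒unique-neighbour : ∀ {n} (G : Graph n) v → degree G v ≤ 1 →
  ∀ {u w} → adj G v u ≡ true → adj G v w ≡ true → u ≡ w
degree≤1⇒unique-neighbour {suc n} G v deg≤1 {u} {w} vu vw with u ≟ w
... | yes u≡w = u≡w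
... | no u≢w = contradiction (ℕ.≤-trans two≤deg deg≤1) λ { (s≤s ()) }
  where
  f = λ x → 𝟙 (adj G v x)
  1≤f : ∀ {x} → adj G v x ≡ true → 1 ≤ f x
  1≤f vx rewrite vx = s≤s z≤n
  1≤rest : 1 ≤ ∑ (f ∘ punchIn u)
  1≤rest = ℕ.≤-trans (1≤f (trans (cong (adj G v) (Fin.punchIn-punchOut u≢w)) vw))
                     (≤-∑ (punchOut u≢w) (f ∘ punchIn u))
  two≤deg : 2 ≤ degree G v
  two≤deg = subst (2 ≤_) (sym (trans (degree-∑ G v) (sum-remove {i = u} f)))
                  (ℕ.+-mono-≤ (1≤f vu) 1≤rest)

removeVertex : ∀ {n} → Graph (suc n) → Fin (suc n) → Graph n
removeVertex G v = record
  { adj    = λ x y → adj G (punchIn v x) (punchIn v y)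
  ; sym    = λ x y → Graph.sym G (punchIn v x) (punchIn v y)
  ; irrefl = λ x → irrefl G (punchIn v x)
  }

removeVertex-forest : ∀ {n} (G : Graph (suc n)) v → IsForest G → IsForest (removeVertex G v)
removeVertex-forest G v forest C = forest record
  { m      = Cycle.m C
  ; c      = punchIn v ∘ Cycle.c C
  ; inj    = Cycle.inj C ∘ Fin.punchIn-injective v _ _
  ; linked = Cycle.linked C
  ; closed = Cycle.closed C
  }

degree-removed : ∀ {n} (G : Graph (suc n)) v → degree G v ≡ ∑ (λ u → 𝟙 (adj G v (punchIn v u)))
degree-removed G v = begin
  degree G v                          ≡⟨ degree-∑ G v ⟩
  ∑ (𝟙 ∘ adj G v)                     ≡⟨ sum-remove {i = v} (𝟙 ∘ adj G v) ⟩
  𝟙 (adj G v v) + ∑ toV               ≡⟨ cong (λ b → 𝟙 b + ∑ toV) (irrefl G v) ⟩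
  ∑ toV                               ∎
  where
  open ≡-Reasoning
  toV = λ u → 𝟙 (adj G v (punchIn v u))

degree-punchIn : ∀ {n} (G : Graph (suc n)) v u →
  degree G (punchIn v u) ≡ 𝟙 (adj G v (punchIn v u)) + degree (removeVertex G v) u
degree-punchIn G v u = begin
  degree G (punchIn v u)                                  ≡⟨ degree-∑ G (punchIn v u) ⟩
  ∑ (𝟙 ∘ adj G (punchIn v u))                             ≡⟨ sum-remove {i = v} (𝟙 ∘ adj G (punchIn v u)) ⟩
  𝟙 (adj G (punchIn v u) v) + ∑ (𝟙 ∘ adj G-v u)           ≡⟨ cong₂ _+_ (cong 𝟙 (Graph.sym G _ v)) (sym (degree-∑ G-v u)) ⟩
  𝟙 (adj G v (punchIn v u)) + degree G-v u                ∎
  where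
  open ≡-Reasoning
  G-v = removeVertex G v

∑degree-removeVertex : ∀ {n} (G : Graph (suc n)) v →
  ∑ (degree G) ≡ degree G v + (degree G v + ∑ (degree (removeVertex G v)))
∑degree-removeVertex G v = begin
  ∑ (degree G)                                  ≡⟨ sum-remove {i = v} (degree G) ⟩
  degree G v + ∑ (degree G ∘ punchIn v)         ≡⟨ cong (degree G v +_) (sum-cong-≗ (degree-punchIn G v)) ⟩
  degree G v + ∑ (λ u → toV u + degree G-v u)   ≡⟨ cong (degree G v +_) (∑-distrib-+ toV (degree G-v)) ⟩
  degree G v + (∑ toV + ∑ (degree G-v))         ≡⟨ cong (λ δ → degree G v + (δ + ∑ (degree G-v))) (degree-removed G v) ⟨
  degree G v + (degree G v + ∑ (degree G-v))    ∎
  where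
  open ≡-Reasoning
  G-v = removeVertex G v
  toV = λ u → 𝟙 (adj G v (punchIn v u))

-- Leaves of forests

module _ {n} (G : Graph n) (w : ℕ → Fin n)
         (walk : ∀ i → adj G (w i) (w (suc i)) ≡ true)
         (nonBacktracking : ∀ i → w (suc (suc i)) ≢ w i) where

  firstReturn⇒cycle : ∀ {i j} → i < j → w i ≡ w j →
                      (∀ {x y} → x < y → y < j → w x ≢ w y) → Cycle G
  firstReturn⇒cycle {i} i<j wi≡wj distinct with ℕ.m≤n⇒∃[o]m+o≡n i<j
  ... | zero , refl =
    contradiction (trans (sym (walk i)) (trans (cong (adj G (w i)) (sym wi≡wi+1)) (irrefl G (w i)))) λ ()
    where
    wi≡wi+1 : w i ≡ w (suc i)
    wi≡wi+1 = trans wi≡wj (cong w (ℕ.+-identityʳ (suc i)))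
  ... | suc zero , refl =
    ⊥-elim (nonBacktracking i (sym (trans wi≡wj (cong w (ℕ.+-comm (suc i) 1)))))
  ... | suc (suc L) , refl = record { m = L ; c = c ; inj = inj ; linked = linked ; closed = closed }
    where
    c : Fin (3 + L) → Fin n
    c t = w (i + toℕ t)
    inside : ∀ t → i + toℕ t < suc i + suc (suc L)
    inside t = subst (i + toℕ t <_) (ℕ.+-suc i (2 + L)) (ℕ.+-monoʳ-< i (Fin.toℕ<n t))
    inj : Injective _≡_ _≡_ c
    inj {s} {t} cs≡ct with ℕ.<-cmp (toℕ s) (toℕ t)
    ... | tri< s<t _ _ = contradiction cs≡ct (distinct (ℕ.+-monoʳ-< i s<t) (inside t))
    ... | tri≈ _ s≡t _ = Fin.toℕ-injective s≡t
    ... | tri> _ _ t<s = contradiction (sym cs≡ct) (distinct (ℕ.+-monoʳ-< i t<s) (inside s))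
    linked : ∀ t → adj G (c (inject₁ t)) (c (suc t)) ≡ true
    linked t = subst₂ (λ x y → adj G (w x) (w y) ≡ true)
      (cong (i +_) (sym (Fin.toℕ-inject₁ t))) (sym (ℕ.+-suc i (toℕ t))) (walk (i + toℕ t))
    closed : adj G (c (fromℕ (2 + L))) (c zero) ≡ true
    closed = subst₂ (λ x y → adj G (w x) y ≡ true)
      (cong (i +_) (sym (Fin.toℕ-fromℕ (2 + L))))
      (trans (sym wi≡wj) (cong w (sym (ℕ.+-identityʳ i))))
      (walk (i + (2 + L)))

module NonBacktrackingWalk {n} (G : Graph n) (2≤degree : ∀ v → 2 ≤ degree G v) (start : Fin n) where

  anotherNeighbour : ∀ u x → Σ (Fin n) λ y → adj G u y ≡ true × y ≢ x
  anotherNeighbour u x with any? (λ y → (adj G u y Bool.≟ true) ×-dec ¬? (y ≟ x))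
  ... | yes found = found
  ... | no none = contradiction deg≤1 (ℕ.<⇒≱ (2≤degree u))
    where
    only-x : ∀ y → y ≢ x → 𝟙 (adj G u y) ≡ 0
    only-x y y≢x with adj G u y in uy
    ... | true  = contradiction (y , uy , y≢x) none
    ... | false = refl
    deg≤1 : degree G u ≤ 1
    deg≤1 = subst (_≤ 1) (sym (trans (degree-∑ G u) (∑-single x _ only-x))) (𝟙≤1 _)

  edge : ℕ → Fin n × Fin n
  edge zero    = start , proj₁ (anotherNeighbour start start)
  edge (suc i) = proj₂ (edge i) , proj₁ (anotherNeighbour (proj₂ (edge i)) (proj₁ (edge i)))

  w : ℕ → Fin n
  w = proj₁ ∘ edge

  walk : ∀ i → adj G (w i) (w (suc i)) ≡ true
  walk zero    = proj₁ (proj₂ (anotherNeighbour start start))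
  walk (suc i) = proj₁ (proj₂ (anotherNeighbour (proj₂ (edge i)) (proj₁ (edge i))))

  nonBacktracking : ∀ i → w (suc (suc i)) ≢ w i
  nonBacktracking i = proj₂ (proj₂ (anotherNeighbour (proj₂ (edge i)) (proj₁ (edge i))))

  ReturnsAt : ℕ → Set
  ReturnsAt j = Σ (Fin j) λ a → w (toℕ a) ≡ w j

  returnsAt : ∀ {i j} → i < j → w i ≡ w j → ReturnsAt j
  returnsAt i<j wi≡wj = fromℕ< i<j , trans (cong w (Fin.toℕ-fromℕ< i<j)) wi≡wj

  returnsAt? : ∀ j → Dec (ReturnsAt j)
  returnsAt? j = any? λ a → w (toℕ a) ≟ w j

  someReturn : ¬ (∀ (t : Fin (suc n)) → ¬ ReturnsAt (toℕ t))
  someReturn noReturn with Fin.pigeonhole (ℕ.n<1+n n) (w ∘ toℕ)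
  ... | i , j , i<j , wi≡wj = noReturn j (returnsAt i<j wi≡wj)

  cycle : Cycle G
  cycle with Fin.¬∀⟶∃¬-smallest (suc n) _ (λ t → ¬? (returnsAt? (toℕ t))) someReturn
  ... | j , returns , earlier with decidable-stable (returnsAt? (toℕ j)) returns
  ... | a , wa≡wj = firstReturn⇒cycle G w walk nonBacktracking (Fin.toℕ<n a) wa≡wj distinct
    where
    distinct : ∀ {x y} → x < y → y < toℕ j → w x ≢ w y
    distinct {x} {y} x<y y<j wx≡wy = earlier (fromℕ< y<j)
      (subst ReturnsAt (sym (trans (Fin.toℕ-inject (fromℕ< y<j)) (Fin.toℕ-fromℕ< y<j))) (returnsAt x<y wx≡wy))

forest-leaf : ∀ {n} (G : Graph (suc n)) → IsForest G → ∃ λ v → degree G v ≤ 1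
forest-leaf G forest with any? (λ v → degree G v ≤? 1)
... | yes leaf = leaf
... | no noLeaf = ⊥-elim (forest (NonBacktrackingWalk.cycle G (λ v → ℕ.≰⇒> (noLeaf ∘ (v ,_))) zero))

forest-∑degree : ∀ {n} (G : Graph n) → IsForest G → ∑ (degree G) ≤ 2 * n
forest-∑degree {zero}  G forest = z≤n
forest-∑degree {suc n} G forest with forest-leaf G forest
... | v , deg≤1 = begin
  ∑ (degree G)                                                ≡⟨ ∑degree-removeVertex G v ⟩
  degree G v + (degree G v + ∑ (degree (removeVertex G v)))   ≤⟨ ℕ.+-mono-≤ deg≤1 (ℕ.+-mono-≤ deg≤1 ∑≤) ⟩
  2 + 2 * n                                                   ≡⟨ ℕ.*-suc 2 n ⟨
  2 * suc n                                                   ∎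
  where
  open ℕ.≤-Reasoning
  ∑≤ = forest-∑degree (removeVertex G v) (removeVertex-forest G v forest)

goodForest-internal : ∀ {d} (F : GoodForest d) → 2 * k F ≤ d
goodForest-internal {d} F = ℕ.+-cancelˡ-≤ (d + 2 * k F) (2 * k F) d (begin
  (d + 2 * k F) + 2 * k F                         ≡⟨ lhs d (k F) ⟩
  d * 1 + k F * 4                                 ≤⟨ ℕ.+-mono-≤ leafDegrees internalDegrees ⟩
  ∑ (degree G ∘ (_↑ˡ k F)) + ∑ (degree G ∘ (d ↑ʳ_)) ≡⟨ ∑-↑ d (degree G) ⟨
  ∑ (degree G)                                    ≤⟨ forest-∑degree G (forest F) ⟩
  2 * (d + k F)                                   ≡⟨ rhs d (k F) ⟩
  (d + 2 * k F) + d                               ∎)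
  where
  open ℕ.≤-Reasoning
  G = graph F
  leafDegrees = ∑-lowerBound 1 (degree G ∘ (_↑ˡ k F)) (λ i → ℕ.≤-reflexive (sym (leaves F i)))
  internalDegrees = ∑-lowerBound 4 (degree G ∘ (d ↑ʳ_)) (λ j → proj₁ (proj₂ (good F) _ (internal F j)))
  lhs : ∀ d k → (d + 2 * k) + 2 * k ≡ d * 1 + k * 4
  lhs = solve-∀
  rhs : ∀ d k → 2 * (d + k) ≡ (d + 2 * k) + d
  rhs = solve-∀

-- Parent codes

ParentEdge : ∀ {n} → (Fin n → Fin n) → Fin n → Fin n → Set
ParentEdge p u v = u ≢ v × (p u ≡ v ⊎ p v ≡ u)

parentEdge? : ∀ {n} (p : Fin n → Fin n) u v → Dec (ParentEdge p u v)
parentEdge? p u v = ¬? (u ≟ v) ×-dec (p u ≟ v ⊎-dec p v ≟ u)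

parentGraph : ∀ {n} → (Fin n → Fin n) → Graph n
parentGraph p = record
  { adj    = λ u v → does (parentEdge? p u v)
  ; sym    = λ u v → does-⇔ (mk⇔ flipEdge flipEdge) (parentEdge? p u v) (parentEdge? p v u)
  ; irrefl = λ u → dec-false (parentEdge? p u u) λ (u≢u , _) → u≢u refl
  }
  where
  flipEdge : ∀ {u v} → ParentEdge p u v → ParentEdge p v u
  flipEdge (u≢v , edge) = u≢v ∘ sym , Sum.swap edge

parentGraph-cong : ∀ {n} {p q : Fin n → Fin n} → p ≗ q → parentGraph p ≈ᴳ parentGraph q
parentGraph-cong p≗q u v rewrite p≗q u | p≗q v = refl

≡-does : ∀ {A : Set} (b : Bool) → (b ≡ true ⇔ A) → (a? : Dec A) → b ≡ does a?
≡-does true  b⇔A a? = sym (dec-true a? (Equivalence.to b⇔A refl))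
≡-does false b⇔A a? = sym (dec-false a? λ a → case Equivalence.from b⇔A a of λ ())

punchIn-view : ∀ {n} (v x : Fin (suc n)) → v ≡ x ⊎ ∃ λ x′ → punchIn v x′ ≡ x
punchIn-view v x with v ≟ x
... | yes v≡x = inj₁ v≡x
... | no v≢x  = inj₂ (punchOut v≢x , Fin.punchIn-punchOut v≢x)

module _ {n} (v r : Fin (suc n)) (p : Fin n → Fin n) where

  extendParent : Fin (suc n) → Fin (suc n)
  extendParent x with v ≟ x
  ... | yes _   = r
  ... | no v≢x  = punchIn v (p (punchOut v≢x))

  extendParent-v : extendParent v ≡ r
  extendParent-v with v ≟ v
  ... | yes _  = refl
  ... | no v≢v = contradiction refl v≢v

  extendParent-punchIn : ∀ x → extendParent (punchIn v x) ≡ punchIn v (p x)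
  extendParent-punchIn x with v ≟ punchIn v x
  ... | yes v≡x = contradiction (sym v≡x) (Fin.punchInᵢ≢i v x)
  ... | no _    = cong (punchIn v ∘ p) (trans (Fin.punchOut-cong v refl) (Fin.punchOut-punchIn v))

  extendParent-edge-v : ∀ y → ParentEdge extendParent v (punchIn v y) ⇔ r ≡ punchIn v y
  extendParent-edge-v y = mk⇔ to from
    where
    to : ParentEdge extendParent v (punchIn v y) → r ≡ punchIn v y
    to (_ , inj₁ qv≡y) = trans (sym extendParent-v) qv≡y
    to (_ , inj₂ qy≡v) = contradiction (trans (sym (extendParent-punchIn y)) qy≡v) (Fin.punchInᵢ≢i v (p y))
    from : r ≡ punchIn v y → ParentEdge extendParent v (punchIn v y)
    from r≡y = Fin.punchInᵢ≢i v y ∘ sym , inj₁ (trans extendParent-v r≡y)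

  extendParent-edge-punchIn : ∀ x y →
    ParentEdge extendParent (punchIn v x) (punchIn v y) ⇔ ParentEdge p x y
  extendParent-edge-punchIn x y = mk⇔
    (λ (x≢y , edge) → x≢y ∘ cong (punchIn v) , Sum.map (lower x y) (lower y x) edge)
    (λ (x≢y , edge) → x≢y ∘ Fin.punchIn-injective v x y , Sum.map (lift x y) (lift y x) edge)
    where
    lower : ∀ a b → extendParent (punchIn v a) ≡ punchIn v b → p a ≡ b
    lower a b eq = Fin.punchIn-injective v _ _ (trans (sym (extendParent-punchIn a)) eq)
    lift : ∀ a b → p a ≡ b → extendParent (punchIn v a) ≡ punchIn v b
    lift a b eq = trans (extendParent-punchIn a) (cong (punchIn v) eq)

module _ {n} (G : Graph (suc n)) (v : Fin (suc n)) (deg≤1 : degree G v ≤ 1) where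

  leafParent : Dec (∃ λ u → adj G v u ≡ true) → Fin (suc n)
  leafParent (yes (u , _)) = u
  leafParent (no _)        = v

  leafEdge : ∀ neighbour? {y} → y ≢ v → adj G v y ≡ true ⇔ leafParent neighbour? ≡ y
  leafEdge (yes (u , vu)) y≢v = mk⇔ (degree≤1⇒unique-neighbour G v deg≤1 vu) λ { refl → vu }
  leafEdge (no none)      y≢v = mk⇔ (λ vy → contradiction (_ , vy) none) (λ v≡y → contradiction (sym v≡y) y≢v)

  leaf-parentCode : ∀ {p} → removeVertex G v ≈ᴳ parentGraph p → ∃ λ q → G ≈ᴳ parentGraph q
  leaf-parentCode {p} G-v≈p = q , G≈q
    where
    neighbour? = any? λ u → adj G v u Bool.≟ true
    r = leafParent neighbour?
    q = extendParent v r p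

    edgeAtLeaf : ∀ y → adj G v (punchIn v y) ≡ adj (parentGraph q) v (punchIn v y)
    edgeAtLeaf y = ≡-does (adj G v (punchIn v y))
      (⇔-sym (extendParent-edge-v v r p y) ⇔-∘ leafEdge neighbour? (Fin.punchInᵢ≢i v y))
      (parentEdge? q v (punchIn v y))

    G≈q : G ≈ᴳ parentGraph q
    G≈q x y with punchIn-view v x | punchIn-view v y
    ... | inj₁ refl         | inj₁ refl         = trans (irrefl G v) (sym (irrefl (parentGraph q) v))
    ... | inj₁ refl         | inj₂ (y′ , refl)  = edgeAtLeaf y′
    ... | inj₂ (x′ , refl)  | inj₁ refl         =
      trans (Graph.sym G _ v) (trans (edgeAtLeaf x′) (Graph.sym (parentGraph q) v _))
    ... | inj₂ (x′ , refl)  | inj₂ (y′ , refl)  =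
      trans (G-v≈p x′ y′) (does-⇔ (⇔-sym (extendParent-edge-punchIn v r p x′ y′))
                                    (parentEdge? p x′ y′) (parentEdge? q (punchIn v x′) (punchIn v y′)))

forest-parentCode : ∀ {n} (G : Graph n) → IsForest G → ∃ λ p → G ≈ᴳ parentGraph p
forest-parentCode {zero}  G forest = (λ ()) , λ ()
forest-parentCode {suc n} G forest with forest-leaf G forest
... | v , deg≤1 with forest-parentCode (removeVertex G v) (removeVertex-forest G v forest)
... | p , G-v≈p = leaf-parentCode G v deg≤1 {p} G-v≈p

-- Exhaustive search

Extensional : ∀ {a b} → ((Fin a → Fin b) → Set) → Set
Extensional P = ∀ {f g} → f ≗ g → P f → P g

∃-function? : ∀ {a b} {P : (Fin a → Fin b) → Set} → Extensional P → (∀ f → Dec (P f)) → Dec (∃ P)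
∃-function? P-ext P? = map′ (λ (i , Pi) → finToFun i , Pi)
  (λ (f , Pf) → funToFin f , P-ext (λ x → sym (Fin.finToFun-funToFin f x)) Pf)
  (any? (P? ∘ finToFun))

injective? : ∀ {a b} (f : Fin a → Fin b) → Dec (Injective _≡_ _≡_ f)
injective? f = map′ (λ inj → inj _ _) (λ inj _ _ → inj) (all? λ x → all? λ y → f x ≟ f y →-dec x ≟ y)

surjective? : ∀ {a b} (f : Fin a → Fin b) → Dec (Surjective _≡_ _≡_ f)
surjective? f = map′ (λ surj y → proj₁ (surj y) , λ { refl → proj₂ (surj y) })
                     (λ surj y → proj₁ (surj y) , proj₂ (surj y) refl)
                     (all? λ y → any? λ x → f x ≟ y)

injective-ext : ∀ {a b} → Extensional {a} {b} (Injective _≡_ _≡_)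
injective-ext f≗g inj gx≡gy = inj (trans (f≗g _) (trans gx≡gy (sym (f≗g _))))

surjective-ext : ∀ {a b} → Extensional {a} {b} (Surjective _≡_ _≡_)
surjective-ext f≗g surj y = proj₁ (surj y) , λ { refl → trans (sym (f≗g _)) (proj₂ (surj y) refl) }

IsCycle : ∀ {n} → Graph n → (m : ℕ) → (Fin (3 + m) → Fin n) → Set
IsCycle G m c = Injective _≡_ _≡_ c
              × (∀ i → adj G (c (inject₁ i)) (c (suc i)) ≡ true)
              × adj G (c (fromℕ (2 + m))) (c zero) ≡ true

isCycle? : ∀ {n} (G : Graph n) m c → Dec (IsCycle G m c)
isCycle? G m c = injective? c
           ×-dec (all? λ i → adj G (c (inject₁ i)) (c (suc i)) Bool.≟ true)
           ×-dec (adj G (c (fromℕ (2 + m))) (c zero) Bool.≟ true)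

isCycle-ext : ∀ {n} (G : Graph n) m → Extensional (IsCycle G m)
isCycle-ext G m {c} {c′} c≗c′ (inj , linked , closed) =
  injective-ext c≗c′ inj , (λ i → transport (linked i)) , transport closed
  where
  transport : ∀ {x y} → adj G (c x) (c y) ≡ true → adj G (c′ x) (c′ y) ≡ true
  transport {x} {y} = subst₂ (λ u v → adj G u v ≡ true) (c≗c′ x) (c≗c′ y)

cycle? : ∀ {n} (G : Graph n) → Dec (Cycle G)
cycle? {n} G with any? (λ (m : Fin n) → ∃-function? (isCycle-ext G (toℕ m)) (isCycle? G (toℕ m)))
... | yes (m , c , inj , linked , closed) =
  yes record { m = toℕ m ; c = c ; inj = inj ; linked = linked ; closed = closed }
... | no none = no λ C → none (fromℕ< (length< C) ,
  subst (λ m → ∃ (IsCycle G m)) (sym (Fin.toℕ-fromℕ< (length< C)))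
        (Cycle.c C , Cycle.inj C , Cycle.linked C , Cycle.closed C))
  where
  length< : (C : Cycle G) → Cycle.m C < n
  length< C = ℕ.≤-trans (ℕ.m≤n+m _ 2) (Fin.injective⇒≤ (Cycle.inj C))

good? : ∀ {n} (G : Graph n) → Dec (IsGood G)
good? G = (all? λ v → 1 ≤? degree G v)
    ×-dec (all? λ v → ¬? (degree G v ℕ.≟ 1) →-dec (4 ≤? degree G v ×-dec 2 ∣? degree G v))

-- Isomorphism classes

module _ {d : ℕ} where

  iso-refl : ∀ {F : GoodForest d} → Iso F F
  iso-refl = record { σ = id ; bij = Identity.bijective _≡_ ; labels = λ _ → refl ; preserve = λ _ _ → refl }

  iso-sym : ∀ {F G : GoodForest d} → Iso F G → Iso G F
  iso-sym {F} {G} I = record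
    { σ        = from
    ; bij      = Bijection.bijective (↔⇒⤖ (↔-sym σ↔))
    ; labels   = λ i → trans (cong from (sym (Iso.labels I i))) (strictlyInverseʳ _)
    ; preserve = λ u v → trans (sym (Iso.preserve I (from u) (from v)))
                               (cong₂ (adj (graph G)) (strictlyInverseˡ u) (strictlyInverseˡ v))
    }
    where
    σ↔ = ⤖⇒↔ (mk⤖ (Iso.bij I))
    open Inverse σ↔ using (from; strictlyInverseˡ; strictlyInverseʳ)

  iso-trans : ∀ {F G H : GoodForest d} → Iso F G → Iso G H → Iso F H
  iso-trans I J = record
    { σ        = Iso.σ J ∘ Iso.σ I
    ; bij      = Composition.bijective _≡_ _≡_ _≡_ (Iso.bij I) (Iso.bij J)
    ; labels   = λ i → trans (cong (Iso.σ J) (Iso.labels I i)) (Iso.labels J i)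
    ; preserve = λ u v → trans (Iso.preserve J _ _) (Iso.preserve I u v)
    }

  IsIso : (F G : GoodForest d) → (Fin (d + k F) → Fin (d + k G)) → Set
  IsIso F G σ = Bijective _≡_ _≡_ σ
              × (∀ i → σ (i ↑ˡ k F) ≡ i ↑ˡ k G)
              × (∀ u v → adj (graph G) (σ u) (σ v) ≡ adj (graph F) u v)

  iso? : ∀ F G → Dec (Iso F G)
  iso? F G = map′ (λ (σ , bij , labels , preserve) → record { σ = σ ; bij = bij ; labels = labels ; preserve = preserve })
                  (λ I → Iso.σ I , Iso.bij I , Iso.labels I , Iso.preserve I)
                  (∃-function? isIso-ext isIso?)
    where
    isIso? : ∀ σ → Dec (IsIso F G σ)
    isIso? σ = (injective? σ ×-dec surjective? σ)
         ×-dec (all? λ i → σ (i ↑ˡ k F) ≟ i ↑ˡ k G)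
         ×-dec (all? λ u → all? λ v → adj (graph G) (σ u) (σ v) Bool.≟ adj (graph F) u v)
    isIso-ext : Extensional (IsIso F G)
    isIso-ext σ≗τ ((inj , surj) , labels , preserve) =
      (injective-ext σ≗τ inj , surjective-ext σ≗τ surj) ,
      (λ i → trans (sym (σ≗τ _)) (labels i)) ,
      (λ u v → trans (cong₂ (adj (graph G)) (sym (σ≗τ u)) (sym (σ≗τ v))) (preserve u v))

  isoDecSetoid : DecSetoid 0ℓ 0ℓ
  isoDecSetoid = record
    { Carrier          = GoodForest d
    ; _≈_              = Iso
    ; isDecEquivalence = record
      { isEquivalence = record { refl = iso-refl ; sym = iso-sym ; trans = iso-trans }
      ; _≟_           = iso?
      }
    }

module _ {a ℓ} (S : Setoid a ℓ) where
  open Setoid S using (_≈_) renaming (sym to ≈-sym)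
  open import Data.List.Relation.Unary.Unique.Setoid S using (Unique; _∷_)

  unique⇒lookup-injective : ∀ {xs} → Unique xs → ∀ i j → lookup xs i ≈ lookup xs j → i ≡ j
  unique⇒lookup-injective (_ ∷ _) zero zero _ = refl
  unique⇒lookup-injective (x≉ ∷ _) zero (suc j) xᵢ≈xⱼ =
    contradiction xᵢ≈xⱼ (All.lookup x≉ (∈-lookup j))
  unique⇒lookup-injective (x≉ ∷ _) (suc i) zero xᵢ≈xⱼ =
    contradiction (≈-sym xᵢ≈xⱼ) (All.lookup x≉ (∈-lookup i))
  unique⇒lookup-injective (_ ∷ u) (suc i) (suc j) xᵢ≈xⱼ = cong suc (unique⇒lookup-injective u i j xᵢ≈xⱼ)

cover⇒cardinality : ∀ {d} (xs : List (GoodForest d)) → (∀ F → Any (Iso F) xs) →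
                    Σ ℕ λ N → HasCardinality d N × N ≤ length xs
cover⇒cardinality {d} xs cover = length ys , (lookup ys , distinct , covered) , List.length-deduplicate iso? xs
  where
  ys = deduplicate iso? xs
  distinct : ∀ i j → Iso (lookup ys i) (lookup ys j) → i ≡ j
  distinct = unique⇒lookup-injective (DecSetoid.setoid isoDecSetoid) (deduplicate-! isoDecSetoid xs)
  covered : ∀ F → Σ (Fin (length ys)) λ i → Iso F (lookup ys i)
  covered F = Any.index F∈ys , Any.lookup-index F∈ys
    where
    F∈ys = Any.deduplicate⁺ iso? (λ G≅H F≅G → iso-trans F≅G (iso-sym G≅H)) (cover F)

-- Enumerating good forests

module _ (d : ℕ) where

  IsGoodForestGraph : (k : ℕ) → Graph (d + k) → Set
  IsGoodForestGraph k G = IsForest G × IsGood G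
                        × (∀ i → degree G (i ↑ˡ k) ≡ 1) × (∀ j → degree G (d ↑ʳ j) ≢ 1)

  isGoodForestGraph? : ∀ k G → Dec (IsGoodForestGraph k G)
  isGoodForestGraph? k G = ¬? (cycle? G) ×-dec good? G
                     ×-dec (all? λ i → degree G (i ↑ˡ k) ℕ.≟ 1) ×-dec (all? λ j → ¬? (degree G (d ↑ʳ j) ℕ.≟ 1))

  isGoodForestGraph-cong : ∀ {k} {G H : Graph (d + k)} → G ≈ᴳ H → IsGoodForestGraph k G → IsGoodForestGraph k H
  isGoodForestGraph-cong {G = G} {H} G≈H (forest , (nonIsolated , internalDegree) , leaves , internal) =
    forest ∘ cycle-cong (λ u v → sym (G≈H u v)) ,
    ((λ v → subst (1 ≤_) (deg≡ v) (nonIsolated v)) ,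
     (λ v deg≢1 → subst (λ δ → 4 ≤ δ × 2 ∣ δ) (deg≡ v) (internalDegree v (deg≢1 ∘ trans (sym (deg≡ v)))))) ,
    (λ i → trans (sym (deg≡ _)) (leaves i)) ,
    (λ j → internal j ∘ trans (deg≡ _))
    where
    deg≡ : ∀ v → degree G v ≡ degree H v
    deg≡ = degree-cong {G = G} {H} G≈H

  toGoodForest : ∀ {k G} → IsGoodForestGraph k G → GoodForest d
  toGoodForest {k} {G} (forest , good , leaves , internal) =
    record { k = k ; graph = G ; forest = forest ; good = good ; leaves = leaves ; internal = internal }

  ≈ᴳ⇒iso : ∀ (F : GoodForest d) {H} (H-good : IsGoodForestGraph (k F) H) → graph F ≈ᴳ H → Iso F (toGoodForest H-good)
  ≈ᴳ⇒iso F H-good F≈H = record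
    { σ = id ; bij = Identity.bijective _≡_ ; labels = λ _ → refl ; preserve = λ u v → sym (F≈H u v) }

  codedForest : ∀ k → Fin ((d + k) ^ (d + k)) → Maybe (GoodForest d)
  codedForest k i = Maybe.map toGoodForest (dec⇒maybe (isGoodForestGraph? k (parentGraph (finToFun i))))

  forestsWith : ℕ → List (GoodForest d)
  forestsWith k = mapMaybe (codedForest k) (allFin _)

  forestsWith-complete : ∀ F → Any (Iso F) (forestsWith (k F))
  forestsWith-complete F with forest-parentCode (graph F) (forest F)
  ... | p , F≈p = Any.mapMaybe⁺ (codedForest (k F)) (allFin _)
                    (Any.map⁺ (Any.map (λ { refl → coded (isGoodForestGraph? (k F) _) }) (∈-allFin (funToFin p))))
    where
    F≈code : graph F ≈ᴳ parentGraph (finToFun (funToFin p))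
    F≈code u v = trans (F≈p u v) (parentGraph-cong (λ x → sym (Fin.finToFun-funToFin p x)) u v)
    coded : ∀ D → MaybeAny.Any (Iso F) (Maybe.map toGoodForest (dec⇒maybe D))
    coded (yes H-good) = MaybeAny.just (≈ᴳ⇒iso F H-good F≈code)
    coded (no ¬good)   = contradiction (isGoodForestGraph-cong F≈code (forest F , good F , leaves F , internal F)) ¬good

  length-forestsWith : ∀ k → length (forestsWith k) ≤ (d + k) ^ (d + k)
  length-forestsWith k = ℕ.≤-trans (List.length-mapMaybe (codedForest k) (allFin _))
                                   (ℕ.≤-reflexive (List.length-tabulate id))

  forestsUpTo : ℕ → List (GoodForest d)
  forestsUpTo zero    = forestsWith 0
  forestsUpTo (suc K) = forestsWith (suc K) ++ forestsUpTo K

  forestsUpTo-complete : ∀ K F → k F ≤ K → Any (Iso F) (forestsUpTo K)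
  forestsUpTo-complete zero    F k≤0 = subst (Any (Iso F) ∘ forestsWith) (ℕ.n≤0⇒n≡0 k≤0) (forestsWith-complete F)
  forestsUpTo-complete (suc K) F k≤1+K with ℕ.m≤n⇒m<n∨m≡n k≤1+K
  ... | inj₁ k<1+K = Any.++⁺ʳ (forestsWith (suc K)) (forestsUpTo-complete K F (s≤s⁻¹ k<1+K))
  ... | inj₂ k≡1+K = Any.++⁺ˡ (subst (Any (Iso F) ∘ forestsWith) k≡1+K (forestsWith-complete F))

  length-forestsUpTo : ∀ {b} K → d + K ≤ b → length (forestsUpTo K) ≤ powerSum b d K
  length-forestsUpTo zero    d+0≤b = ℕ.≤-trans (length-forestsWith 0) (ℕ.^-monoˡ-≤ (d + 0) d+0≤b)
  length-forestsUpTo {b} (suc K) d+1+K≤b = begin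
    length (forestsWith (suc K) ++ forestsUpTo K)             ≡⟨ List.length-++ (forestsWith (suc K)) ⟩
    length (forestsWith (suc K)) + length (forestsUpTo K)     ≤⟨ ℕ.+-mono-≤ newest older ⟩
    powerSum b d (suc K)                                      ∎
    where
    open ℕ.≤-Reasoning
    newest = ℕ.≤-trans (length-forestsWith (suc K)) (ℕ.^-monoˡ-≤ (d + suc K) d+1+K≤b)
    older  = length-forestsUpTo K (ℕ.≤-trans (ℕ.+-monoʳ-≤ d (ℕ.n≤1+n K)) d+1+K≤b)

-- Perfect matchings

record PerfectMatching (n : ℕ) : Set where
  field
    partner      : Fin n → Fin n
    involutive   : ∀ x → partner (partner x) ≡ x
    fixpointFree : ∀ x → partner x ≢ x
open PerfectMatching

module _ {n} (M : PerfectMatching n) where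

  matchingGraph : Graph n
  matchingGraph = record
    { adj    = λ x y → does (y ≟ partner M x)
    ; sym    = λ x y → does-⇔ (mk⇔ (λ { refl → sym (involutive M x) }) (λ { refl → sym (involutive M y) }))
                                (y ≟ partner M x) (x ≟ partner M y)
    ; irrefl = λ x → dec-false (x ≟ partner M x) (fixpointFree M x ∘ sym)
    }

  matchingGraph-edge : ∀ {x y} → adj matchingGraph x y ≡ true → y ≡ partner M x
  matchingGraph-edge {x} {y} xy with y ≟ partner M x
  ... | yes y≡μx = y≡μx
  ... | no _     = case xy of λ ()

  matchingGraph-degree : ∀ x → degree matchingGraph x ≡ 1
  matchingGraph-degree x = begin
    degree matchingGraph x                          ≡⟨ degree-∑ matchingGraph x ⟩
    ∑ (λ y → 𝟙 (does (y ≟ partner M x)))            ≡⟨ ∑-single (partner M x) _ (λ y → cong 𝟙 ∘ dec-false (y ≟ _)) ⟩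
    𝟙 (does (partner M x ≟ partner M x))            ≡⟨ cong 𝟙 (dec-true (partner M x ≟ partner M x) refl) ⟩
    1                                               ∎
    where open ≡-Reasoning

  -- In a cycle c₀ c₁ … cₗ both c₁ and cₗ are neighbours of c₀, hence equal.
  matchingGraph-forest : IsForest matchingGraph
  matchingGraph-forest C = case Cycle.inj C (trans c₁≡μc₀ (sym cₗ≡μc₀)) of λ ()
    where
    c = Cycle.c C
    l = fromℕ (2 + Cycle.m C)
    c₁≡μc₀ : c (suc zero) ≡ partner M (c zero)
    c₁≡μc₀ = matchingGraph-edge (Cycle.linked C zero)
    cₗ≡μc₀ : c l ≡ partner M (c zero)
    cₗ≡μc₀ = matchingGraph-edge (trans (Graph.sym matchingGraph (c zero) (c l)) (Cycle.closed C))

dropZero : ∀ {d} → Fin (d + 0) → Fin d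
dropZero = cast (ℕ.+-identityʳ _)

dropZero-↑ˡ : ∀ {d} (i : Fin d) → dropZero (i ↑ˡ 0) ≡ i
dropZero-↑ˡ i = Fin.toℕ-injective (trans (Fin.toℕ-cast _ (i ↑ˡ 0)) (Fin.toℕ-↑ˡ i 0))

↑ˡ-dropZero : ∀ {d} (x : Fin (d + 0)) → dropZero x ↑ˡ 0 ≡ x
↑ˡ-dropZero x = Fin.toℕ-injective (trans (Fin.toℕ-↑ˡ (dropZero x) 0) (Fin.toℕ-cast _ x))

padZero : ∀ {d} → PerfectMatching d → PerfectMatching (d + 0)
padZero M = record
  { partner      = μ₀
  ; involutive   = λ x → begin
      μ₀ (μ₀ x)                               ≡⟨ cong (λ y → partner M y ↑ˡ 0) (dropZero-↑ˡ _) ⟩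
      partner M (partner M (dropZero x)) ↑ˡ 0 ≡⟨ cong (_↑ˡ 0) (involutive M _) ⟩
      dropZero x ↑ˡ 0                         ≡⟨ ↑ˡ-dropZero x ⟩
      x                                       ∎
  ; fixpointFree = λ x μ₀x≡x → fixpointFree M (dropZero x)
      (trans (sym (dropZero-↑ˡ _)) (cong dropZero μ₀x≡x))
  }
  where
  open ≡-Reasoning
  μ₀ = λ x → partner M (dropZero x) ↑ˡ 0

matchingForest : ∀ {d} → PerfectMatching d → GoodForest d
matchingForest M = record
  { k        = 0
  ; graph    = matchingGraph (padZero M)
  ; forest   = matchingGraph-forest (padZero M)
  ; good     = (λ v → ℕ.≤-reflexive (sym (degree≡1 v))) , (λ v deg≢1 → contradiction (degree≡1 v) deg≢1)
  ; leaves   = λ i → degree≡1 (i ↑ˡ 0)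
  ; internal = λ ()
  }
  where
  degree≡1 = matchingGraph-degree (padZero M)

-- An isomorphism fixes every leaf, and here every vertex is a leaf.
matchingForest-injective : ∀ {d} (M N : PerfectMatching d) →
  Iso (matchingForest M) (matchingForest N) → partner M ≗ partner N
matchingForest-injective M N I i = Fin.↑ˡ-injective 0 _ _ (begin
  partner M i ↑ˡ 0                  ≡⟨ cong (λ j → partner M j ↑ˡ 0) (dropZero-↑ˡ i) ⟨
  partner (padZero M) (i ↑ˡ 0)      ≡⟨ matchingGraph-edge (padZero N) N-edge ⟩
  partner (padZero N) (i ↑ˡ 0)      ≡⟨ cong (λ j → partner N j ↑ˡ 0) (dropZero-↑ˡ i) ⟩
  partner N i ↑ˡ 0                  ∎)
  where
  open ≡-Reasoning
  σ-id : ∀ x → Iso.σ I x ≡ x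
  σ-id x = trans (cong (Iso.σ I) (sym (↑ˡ-dropZero x))) (trans (Iso.labels I (dropZero x)) (↑ˡ-dropZero x))
  u = i ↑ˡ 0
  v = partner (padZero M) u
  M-edge : adj (matchingGraph (padZero M)) u v ≡ true
  M-edge = dec-true (v ≟ v) refl
  N-edge : adj (matchingGraph (padZero N)) u v ≡ true
  N-edge = trans (cong₂ (adj (matchingGraph (padZero N))) (sym (σ-id u)) (sym (σ-id v)))
                 (trans (Iso.preserve I u v) M-edge)

swapMatching : ∀ {a b} → Permutation a b → PerfectMatching (a + b)
swapMatching {a} {b} π = record { partner = swapSide ∘ splitAt a ; involutive = twice ; fixpointFree = moves }
  where
  swapSide : Fin a ⊎ Fin b → Fin (a + b)
  swapSide (inj₁ i) = a ↑ʳ (π ⟨$⟩ʳ i)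
  swapSide (inj₂ j) = (π ⟨$⟩ˡ j) ↑ˡ b
  rejoin : ∀ {x s} → splitAt a x ≡ s → join a b s ≡ x
  rejoin {x} refl = Fin.join-splitAt a b x
  twice : ∀ x → swapSide (splitAt a (swapSide (splitAt a x))) ≡ x
  twice x with splitAt a x in split
  ... | inj₁ i rewrite Fin.splitAt-↑ʳ a b (π ⟨$⟩ʳ i) = trans (cong (_↑ˡ b) (Perm.inverseˡ π)) (rejoin split)
  ... | inj₂ j rewrite Fin.splitAt-↑ˡ a (π ⟨$⟩ˡ j) b = trans (cong (a ↑ʳ_) (Perm.inverseʳ π)) (rejoin split)
  moves : ∀ x → swapSide (splitAt a x) ≢ x
  moves x μx≡x with splitAt a x in split
  ... | inj₁ i = case trans (sym (Fin.splitAt-↑ʳ a b _)) (trans (cong (splitAt a) μx≡x) split) of λ ()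
  ... | inj₂ j = case trans (sym (Fin.splitAt-↑ˡ a _ b)) (trans (cong (splitAt a) μx≡x) split) of λ ()

swapMatching-↑ˡ : ∀ {a b} (π : Permutation a b) i → partner (swapMatching π) (i ↑ˡ b) ≡ a ↑ʳ (π ⟨$⟩ʳ i)
swapMatching-↑ˡ {a} {b} π i rewrite Fin.splitAt-↑ˡ a i b = refl

swapMatching-injective : ∀ {a b} (π ρ : Permutation a b) →
  partner (swapMatching π) ≗ partner (swapMatching ρ) → (π ⟨$⟩ʳ_) ≗ (ρ ⟨$⟩ʳ_)
swapMatching-injective {a} {b} π ρ same i = Fin.↑ʳ-injective a _ _ (begin
  a ↑ʳ (π ⟨$⟩ʳ i)                     ≡⟨ swapMatching-↑ˡ π i ⟨
  partner (swapMatching π) (i ↑ˡ b)   ≡⟨ same (i ↑ˡ b) ⟩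
  partner (swapMatching ρ) (i ↑ˡ b)   ≡⟨ swapMatching-↑ˡ ρ i ⟩
  a ↑ʳ (ρ ⟨$⟩ʳ i)                     ∎)
  where open ≡-Reasoning

-- Reads x in mixed radix (n + 1) · n!: the leading digit is the image of 0.
permutationOf : ∀ n → Fin (n !) → Permutation′ n
permutationOf zero    _ = Perm.id
permutationOf (suc n) x = uncurry (λ i r → Perm.insert zero i (permutationOf n r)) (remQuot {suc n} (n !) x)

permutationOf-injective : ∀ n {x y} → (permutationOf n x ⟨$⟩ʳ_) ≗ (permutationOf n y ⟨$⟩ʳ_) → x ≡ y
permutationOf-injective zero    {zero} {zero} _ = refl
permutationOf-injective (suc n) {x} {y} same = begin
  x                         ≡⟨ Fin.combine-remQuot {suc n} (n !) x ⟨
  combine iˣ rˣ             ≡⟨ cong₂ combine iˣ≡iʸ (permutationOf-injective n rest≡) ⟩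
  combine iʸ rʸ             ≡⟨ Fin.combine-remQuot {suc n} (n !) y ⟩
  y                         ∎
  where
  open ≡-Reasoning
  iˣ = proj₁ (remQuot {suc n} (n !) x)
  rˣ = proj₂ (remQuot {suc n} (n !) x)
  iʸ = proj₁ (remQuot {suc n} (n !) y)
  rʸ = proj₂ (remQuot {suc n} (n !) y)
  iˣ≡iʸ : iˣ ≡ iʸ
  iˣ≡iʸ = same zero
  rest≡ : ∀ k → permutationOf n rˣ ⟨$⟩ʳ k ≡ permutationOf n rʸ ⟨$⟩ʳ k
  rest≡ k = Fin.punchIn-injective iʸ _ _ (begin
    punchIn iʸ (permutationOf n rˣ ⟨$⟩ʳ k)     ≡⟨ cong (λ i → punchIn i (permutationOf n rˣ ⟨$⟩ʳ k)) iˣ≡iʸ ⟨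
    punchIn iˣ (permutationOf n rˣ ⟨$⟩ʳ k)     ≡⟨ Perm.insert-punchIn zero iˣ (permutationOf n rˣ) k ⟨
    permutationOf (suc n) x ⟨$⟩ʳ suc k         ≡⟨ same (suc k) ⟩
    permutationOf (suc n) y ⟨$⟩ʳ suc k         ≡⟨ Perm.insert-punchIn zero iʸ (permutationOf n rʸ) k ⟩
    punchIn iʸ (permutationOf n rʸ ⟨$⟩ʳ k)     ∎)

matchingOf : ∀ m → Fin (m !) → PerfectMatching (2 * m)
matchingOf m t = swapMatching (permutationOf m t Perm.∘ₚ Perm.cast-id (sym (ℕ.+-identityʳ m)))

matchingOf-injective : ∀ m {s t} → partner (matchingOf m s) ≗ partner (matchingOf m t) → s ≡ t
matchingOf-injective m {s} {t} same = permutationOf-injective m λ i → Fin.toℕ-injective (begin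
  toℕ (permutationOf m s ⟨$⟩ʳ i)            ≡⟨ Fin.toℕ-cast _ _ ⟨
  toℕ (cast m≡m+0 (permutationOf m s ⟨$⟩ʳ i)) ≡⟨ cong toℕ (swapMatching-injective _ _ same i) ⟩
  toℕ (cast m≡m+0 (permutationOf m t ⟨$⟩ʳ i)) ≡⟨ Fin.toℕ-cast _ _ ⟩
  toℕ (permutationOf m t ⟨$⟩ʳ i)            ∎)
  where
  open ≡-Reasoning
  m≡m+0 = sym (ℕ.+-identityʳ m)

cardinality-lowerBound : ∀ m {N} → HasCardinality (2 * m) N → m ! ≤ N
cardinality-lowerBound m {N} (representative , _ , classify) = Fin.injective⇒≤ classOf-injective
  where
  forestOf : Fin (m !) → GoodForest (2 * m)
  forestOf = matchingForest ∘ matchingOf m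
  classOf : Fin (m !) → Fin N
  classOf t = proj₁ (classify (forestOf t))
  classOf-injective : Injective _≡_ _≡_ classOf
  classOf-injective {s} {t} same = matchingOf-injective m (matchingForest-injective (matchingOf m s) (matchingOf m t)
    (iso-trans (proj₂ (classify (forestOf s)))
               (iso-sym (subst (Iso (forestOf t) ∘ representative) (sym same) (proj₂ (classify (forestOf t)))))))

cardinality-upperBound : ∀ m → Σ ℕ λ N → HasCardinality (2 * m) N × N ≤ 2 * (3 * m) ^ (3 * m)
cardinality-upperBound m = N , cardinality , (begin
  N                              ≤⟨ N≤length ⟩
  length (forestsUpTo d m)       ≤⟨ length-forestsUpTo d m (ℕ.≤-reflexive (d+m≡3m m)) ⟩
  powerSum (3 * m) d m           ≤⟨ powerSum-≤ (3 * m) d m (ℕ.≤-trans (ℕ.n≤1+n 2) ∘ ℕ.*-monoʳ-≤ 3) ⟩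
  2 * (3 * m) ^ (d + m)          ≡⟨ cong (λ e → 2 * (3 * m) ^ e) (d+m≡3m m) ⟩
  2 * (3 * m) ^ (3 * m)          ∎)
  where
  open ℕ.≤-Reasoning
  d = 2 * m
  cover : ∀ F → Any (Iso F) (forestsUpTo d m)
  cover F = forestsUpTo-complete d m F (ℕ.*-cancelˡ-≤ 2 (goodForest-internal F))
  counted = cover⇒cardinality (forestsUpTo d m) cover
  N = proj₁ counted
  cardinality = proj₁ (proj₂ counted)
  N≤length = proj₂ (proj₂ counted)
  d+m≡3m : ∀ m → 2 * m + m ≡ 3 * m
  d+m≡3m = solve-∀

propositionC7 : ∀ (m : ℕ) → Σ ℕ λ N →
    HasCardinality (2 * m) N × (m ! ≤ N) × (N ≤ 2 * (3 * m) ^ (3 * m))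
propositionC7 m with cardinality-upperBound m
... | N , cardinality , upper = N , cardinality , cardinality-lowerBound m cardinality , upper
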